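{- Let $L$ be a residuated lattice, $n\geq 1$ an integer, and $F$ a filter of $L$. If $F$ is an $n$-fold implicative filter of $L$, then $F$ is an $(n+1)$-fold implicative filter of $L$.
   Context: A residuated lattice is an algebra $(L,\wedge,\vee,\otimes,\rightarrow,0,1)$ such that $(L,\wedge,\vee,0,1)$ is a bounded lattice, $(L,\otimes,1)$ is a commutative monoid, and $x\otimes y\leq z$ iff $x\leq y\rightarrow z$. A filter of $L$ is a nonempty subset closed under $\otimes$ and upward closed. For $x\in L$ and $k\geq1$, $x^k=x\otimes\cdots\otimes x$ ($k$ factors). For $k\geq1$, a subset $F\subseteq L$ is a $k$-fold implicative filter if $1\in F$ and for all $x,y,z\in L$: $x^k\rightarrow(y\rightarrow z)\in F$ and $x^k\rightarrow y\in F$ imply $x^k\rightarrow z\in F$. -}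

module Defs where

open import Level using (Level; _⊔_; suc)
open import Data.Nat using (ℕ; zero) renaming (suc to sucℕ)
open import Data.Product using (_×_; ∃)
open import Relation.Unary using (Pred; _∈_)
open import Algebra.Structures using (IsCommutativeMonoid)
open import Algebra.Lattice.Structures using (IsLattice)

record ResiduatedLattice (c ℓ : Level) : Set (suc (c ⊔ ℓ)) where
  infixr 6 _∨_
  infixr 7 _∧_
  infixr 7 _⊗_
  infixr 5 _⇒_
  infix 4 _≈_ _≤_
  field
    Carrier : Set c
    _≈_     : Carrier → Carrier → Set ℓ
    _∧_     : Carrier → Carrier → Carrier
    _∨_     : Carrier → Carrier → Carrier
    _⊗_     : Carrier → Carrier → Carrier
    _⇒_     : Carrier → Carrier → Carrier
    0#      : Carrier
    1#      : Carrier
    isLattice           : IsLattice _≈_ _∨_ _∧_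
    isCommutativeMonoid : IsCommutativeMonoid _≈_ _⊗_ 1#

  _≤_ : Carrier → Carrier → Set ℓ
  x ≤ y = (x ∧ y) ≈ x

  field
    0-least    : ∀ x → 0# ≤ x
    1-greatest : ∀ x → x ≤ 1#
    residuation-⇒ : ∀ x y z → (x ⊗ y) ≤ z → x ≤ (y ⇒ z)
    residuation-⇐ : ∀ x y z → x ≤ (y ⇒ z) → (x ⊗ y) ≤ z

  -- x ^ k = x ⊗ ⋯ ⊗ x  (k factors, k ≥ 1); x ^ 0 = 1 (unused)
  _^_ : Carrier → ℕ → Carrier
  x ^ zero = 1#
  x ^ sucℕ zero = x
  x ^ sucℕ (sucℕ k) = x ⊗ (x ^ sucℕ k)

  record IsFilter {p : Level} (F : Pred Carrier p) : Set (c ⊔ ℓ ⊔ p) where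
    field
      nonempty  : ∃ λ x → x ∈ F
      ⊗-closed  : ∀ {x y} → x ∈ F → y ∈ F → (x ⊗ y) ∈ F
      up-closed : ∀ {x y} → x ∈ F → x ≤ y → y ∈ F

  record IsKFoldImplicative {p : Level} (k : ℕ) (F : Pred Carrier p) : Set (c ⊔ p) where
    field
      one∈ : 1# ∈ F
      mp   : ∀ x y z → ((x ^ k) ⇒ (y ⇒ z)) ∈ F → ((x ^ k) ⇒ y) ∈ F → ((x ^ k) ⇒ z) ∈ F

-- Write a = xⁿ.  In an n-fold implicative filter F, taking y = a in the
-- defining rule (a ⇒ a ∈ F because 1 ≤ a ⇒ a) shows that a ⇒ (a ⇒ w) ∈ F
-- implies a ⇒ w ∈ F.  Since a ⊗ a ≤ x ⊗ a = xⁿ⁺¹, any xⁿ⁺¹ ⇒ w ∈ F gives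
-- (a ⊗ a) ⇒ w ≤ a ⇒ (a ⇒ w) in F, hence a ⇒ w ∈ F.  So the hypotheses of
-- the (n+1)-fold rule yield those of the n-fold rule, which gives a ⇒ z ∈ F,
-- and xⁿ⁺¹ ≤ a turns this into xⁿ⁺¹ ⇒ z ∈ F.
module Submission where

open import Defs
open import Level using (Level)
open import Data.Nat using (ℕ; _≤_; _+_; s≤s; z≤n) renaming (suc to sucℕ; zero to zeroℕ)
open import Data.Nat.Properties using (+-comm)
open import Relation.Unary using (Pred; _∈_)
open import Relation.Binary.Bundles using (Preorder; Poset)
open import Relation.Binary.PropositionalEquality using (subst)
open import Algebra.Structures using (IsCommutativeMonoid)
open import Algebra.Lattice.Bundles using (Lattice)
open import Algebra.Lattice.Properties.Lattice using (poset)
import Relation.Binary.Reasoning.Preorder as PreorderReasoning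

module ResiduatedLatticeProperties {c ℓ : Level} (L : ResiduatedLattice c ℓ) where
  open ResiduatedLattice L hiding (_≤_)
  open ResiduatedLattice L using () renaming (_≤_ to _≼_)
  open IsCommutativeMonoid isCommutativeMonoid
    using (isEquivalence; comm; identityˡ) renaming (assoc to ⊗-assoc)

  lattice : Lattice c ℓ
  lattice = record { isLattice = isLattice }

  open Lattice lattice using (sym)
  module NaturalOrder = Poset (poset lattice)

  -- The library's natural order reads x ≈ x ∧ y; Defs orients it as x ∧ y ≈ x.
  ≼-refl : ∀ {x} → x ≼ x
  ≼-refl = sym NaturalOrder.refl

  ≈⇒≼ : ∀ {x y} → x ≈ y → x ≼ y
  ≈⇒≼ x≈y = sym (NaturalOrder.reflexive x≈y)

  ≼-trans : ∀ {x y z} → x ≼ y → y ≼ z → x ≼ z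
  ≼-trans x≼y y≼z = sym (NaturalOrder.trans (sym x≼y) (sym y≼z))

  ≼-preorder : Preorder c ℓ ℓ
  ≼-preorder = record
    { isPreorder = record
      { isEquivalence = isEquivalence
      ; reflexive     = ≈⇒≼
      ; trans         = ≼-trans
      }
    }

  open PreorderReasoning ≼-preorder

  ⇒-eval : ∀ x y → (x ⇒ y) ⊗ x ≼ y
  ⇒-eval x y = residuation-⇐ _ _ _ ≼-refl

  ⊗-monoˡ-≼ : ∀ {x y} z → x ≼ y → x ⊗ z ≼ y ⊗ z
  ⊗-monoˡ-≼ z x≼y = residuation-⇐ _ _ _ (≼-trans x≼y (residuation-⇒ _ _ _ ≼-refl))

  x⊗y≼y : ∀ x y → x ⊗ y ≼ y
  x⊗y≼y x y = begin
    x ⊗ y  ≲⟨ ⊗-monoˡ-≼ y (1-greatest x) ⟩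
    1# ⊗ y ≈⟨ identityˡ y ⟩
    y      ∎

  x⊗y≼x : ∀ x y → x ⊗ y ≼ x
  x⊗y≼x x y = begin
    x ⊗ y ≈⟨ comm x y ⟩
    y ⊗ x ≲⟨ x⊗y≼y y x ⟩
    x     ∎

  ⇒-antitoneˡ : ∀ {x y} z → x ≼ y → y ⇒ z ≼ x ⇒ z
  ⇒-antitoneˡ {x} {y} z x≼y = residuation-⇒ _ _ _ (begin
    (y ⇒ z) ⊗ x ≈⟨ comm _ x ⟩
    x ⊗ (y ⇒ z) ≲⟨ ⊗-monoˡ-≼ _ x≼y ⟩
    y ⊗ (y ⇒ z) ≈⟨ comm y _ ⟩
    (y ⇒ z) ⊗ y ≲⟨ ⇒-eval y z ⟩
    z           ∎)

  ⊗-⇒-curry : ∀ x y z → (x ⊗ y) ⇒ z ≼ x ⇒ (y ⇒ z)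
  ⊗-⇒-curry x y z = residuation-⇒ _ _ _ (residuation-⇒ _ _ _ (begin
    (((x ⊗ y) ⇒ z) ⊗ x) ⊗ y ≈⟨ ⊗-assoc _ x y ⟩
    ((x ⊗ y) ⇒ z) ⊗ x ⊗ y   ≲⟨ ⇒-eval (x ⊗ y) z ⟩
    z                       ∎))

  1≼x⇒x : ∀ x → 1# ≼ x ⇒ x
  1≼x⇒x x = residuation-⇒ _ _ _ (≈⇒≼ (identityˡ x))

  x^suc≼x : ∀ k x → x ^ sucℕ k ≼ x
  x^suc≼x zeroℕ    x = ≼-refl
  x^suc≼x (sucℕ k) x = x⊗y≼x x _

  -- False for exponent 0: x ^ 0 = 1 but x ^ 1 = x.
  x^suc⊗x^suc≼x^2+ : ∀ k x → x ^ sucℕ k ⊗ x ^ sucℕ k ≼ x ^ sucℕ (sucℕ k)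
  x^suc⊗x^suc≼x^2+ k x = ⊗-monoˡ-≼ _ (x^suc≼x k x)

module KFoldImplicativeProperties
  {c ℓ p : Level} (L : ResiduatedLattice c ℓ)
  {F : Pred (ResiduatedLattice.Carrier L) p}
  (isFilter : ResiduatedLattice.IsFilter L F) where

  open ResiduatedLattice L hiding (_≤_)
  open ResiduatedLatticeProperties L
  open IsFilter isFilter using (up-closed)

  module _ {k : ℕ} (implicative : IsKFoldImplicative k F) where
    open IsKFoldImplicative implicative

    ⇒-contract : ∀ x z → (x ^ k) ⇒ ((x ^ k) ⇒ z) ∈ F → (x ^ k) ⇒ z ∈ F
    ⇒-contract x z h = mp x (x ^ k) z h (up-closed one∈ (1≼x⇒x (x ^ k)))

  module _ {k : ℕ} (implicative : IsKFoldImplicative (sucℕ k) F) where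
    open IsKFoldImplicative implicative

    ⇒-lower-exponent : ∀ x w → (x ^ sucℕ (sucℕ k)) ⇒ w ∈ F → (x ^ sucℕ k) ⇒ w ∈ F
    ⇒-lower-exponent x w h = ⇒-contract implicative x w (up-closed h
      (≼-trans (⇒-antitoneˡ w (x^suc⊗x^suc≼x^2+ k x)) (⊗-⇒-curry _ _ w)))

    suc-implicative : IsKFoldImplicative (sucℕ (sucℕ k)) F
    suc-implicative = record
      { one∈ = one∈
      ; mp   = λ x y z h₁ h₂ → up-closed
                 (mp x y z (⇒-lower-exponent x _ h₁) (⇒-lower-exponent x _ h₂))
                 (⇒-antitoneˡ z (x⊗y≼y x (x ^ sucℕ k)))
      }

proposition4p8 : ∀ {c ℓ p : Level} (L : ResiduatedLattice c ℓ) (n : ℕ) → 1 ≤ n → (F : Pred (ResiduatedLattice.Carrier L) p) → ResiduatedLattice.IsFilter L F → ResiduatedLattice.IsKFoldImplicative L n F → ResiduatedLattice.IsKFoldImplicative L (n + 1) F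
proposition4p8 L (sucℕ k) (s≤s z≤n) F isFilter implicative =
  subst (λ m → ResiduatedLattice.IsKFoldImplicative L (sucℕ m) F) (+-comm 1 k)
    (KFoldImplicativeProperties.suc-implicative L isFilter implicative)
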